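{- Let $\mathbb{F}_q$ be a finite field, $P,Q\in\mathbb{F}_q[X]\setminus\{0\}$ coprime with $m=\deg P>n=\deg Q$, and $\mathcal{D}=\{s\in\mathbb{F}_q[X]:\deg s<m\}$. Let $v\in\mathbb{F}_q[X]$ and $\beta\in\mathbb{F}_q((X^{ -1}))$ with $\deg\beta<m$. Then there exists a unique $s\in L(v)$ such that $\deg(\beta-s)<n$.
   Context: $L(v)=\{s\in\mathcal{D}: Q\mid Pv+s\}$, i.e. the set of labels of outgoing edges of $v$ in the expansion graph $T(P/Q)$ (vertex set $\mathbb{F}_q[X]$, edge $v\to w$ labelled $s\in\mathcal{D}$ iff $w=(Pv+s)/Q\in\mathbb{F}_q[X]$). The degree of a Laurent series $\sum_{i\le h}\beta_iX^i$ with $\beta_h\ne0$ is $h$, and $\deg 0=-\infty$. -}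

module Defs where

open import Level using (Level; _⊔_) renaming (suc to lsuc)
open import Algebra.Bundles using (CommutativeRing)
open import Data.Nat as ℕ using (ℕ; zero; suc)
open import Data.Integer as ℤ using (ℤ; +_; -[1+_])
open import Data.Fin using (Fin)
open import Data.List using (List; []; _∷_; map)
open import Data.Product using (∃; _×_; _,_)
open import Relation.Nullary using (¬_)
open import Relation.Binary.PropositionalEquality using (_≡_)

record FiniteField (c ℓ : Level) : Set (lsuc (c ⊔ ℓ)) where
  field
    commRing : CommutativeRing c ℓ
  open CommutativeRing commRing public hiding (ring)
  field
    0≉1       : ¬ (0# ≈ 1#)
    inverse   : ∀ x → ¬ (x ≈ 0#) → ∃ λ y → x * y ≈ 1#
    size      : ℕ
    enum      : Fin size → Carrier
    enum-surj : ∀ x → ∃ λ i → enum i ≈ x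
    enum-inj  : ∀ i j → enum i ≈ enum j → i ≡ j

module PolyOver {c ℓ : Level} (F : FiniteField c ℓ) where
  open FiniteField F

  -- Polynomials in F_q[X]: coefficient lists, constant term first.
  -- Equality is coefficientwise (so trailing zeros are irrelevant).
  Poly : Set c
  Poly = List Carrier

  coeff : Poly → ℕ → Carrier
  coeff []       _       = 0#
  coeff (a ∷ p)  zero    = a
  coeff (a ∷ p)  (suc i) = coeff p i

  _≈ₚ_ : Poly → Poly → Set ℓ
  p ≈ₚ r = ∀ i → coeff p i ≈ coeff r i

  0ₚ 1ₚ : Poly
  0ₚ = []
  1ₚ = 1# ∷ []

  infixl 6 _+ₚ_
  infixl 7 _*ₚ_
  _+ₚ_ : Poly → Poly → Poly
  []      +ₚ r       = r
  (a ∷ p) +ₚ []      = a ∷ p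
  (a ∷ p) +ₚ (b ∷ r) = (a + b) ∷ (p +ₚ r)

  _*ₚ_ : Poly → Poly → Poly
  []      *ₚ r = []
  (a ∷ p) *ₚ r = map (a *_) r +ₚ (0# ∷ (p *ₚ r))

  HasDeg : Poly → ℕ → Set ℓ
  HasDeg p d = ¬ (coeff p d ≈ 0#) × (∀ i → d ℕ.< i → coeff p i ≈ 0#)

  DegLt : Poly → ℕ → Set ℓ
  DegLt p k = ∀ i → k ℕ.≤ i → coeff p i ≈ 0#

  _∣ₚ_ : Poly → Poly → Set (c ⊔ ℓ)
  d ∣ₚ p = ∃ λ w → (d *ₚ w) ≈ₚ p

  Coprime : Poly → Poly → Set (c ⊔ ℓ)
  Coprime p r = ∀ d → d ∣ₚ p → d ∣ₚ r → d ∣ₚ 1ₚ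

  -- Laurent series in X^{-1}: coefficient of X^i for i ∈ ℤ, vanishing
  -- above some bound.
  record Laurent : Set (c ⊔ ℓ) where
    field
      lcoeff  : ℤ → Carrier
      bounded : ∃ λ N → ∀ i → N ℤ.< i → lcoeff i ≈ 0#
  open Laurent public

  pcoeffℤ : Poly → ℤ → Carrier
  pcoeffℤ p (+ i)    = coeff p i
  pcoeffℤ p -[1+ _ ] = 0#

  _-ₗ_ : Laurent → Poly → ℤ → Carrier
  (β -ₗ s) i = lcoeff β i - pcoeffℤ s i

  LDegLt : (ℤ → Carrier) → ℤ → Set ℓ
  LDegLt f k = ∀ i → k ℤ.≤ i → f i ≈ 0#

  -- s ∈ L(v) for the digit set D = {s : deg s < m}: Q ∣ P v + s
  InL : (P Q : Poly) (m : ℕ) (v s : Poly) → Set (c ⊔ ℓ)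
  InL P Q m v s = DegLt s m × (Q ∣ₚ (P *ₚ v +ₚ s))

module Submission where

-- Write t for the truncation of β to its coefficients of X⁰ … X^(m−1).
-- The digit is s = t − r, where r is the remainder of P·v + t on
-- division by Q. Then Q ∣ P·v + s, deg s < m, and s agrees with β in
-- every degree ≥ n because deg r < n. For uniqueness, two such digits s,
-- s′ have a difference s′ − s that is divisible by Q and of degree < n,
-- and a multiple of Q of degree < n is zero.
--
-- The theorem is the case a = P·v.

open import Defs
open import Level using (Level)
open import Algebra.Bundles using (CommutativeRing)
open import Data.Nat as ℕ using (ℕ; zero; suc; _<_; _≤_; s≤s)
import Data.Nat.Properties as ℕP
open import Data.Integer as ℤ using (+_)
open import Data.Product using (∃; ∃₂; _×_; _,_; proj₁; proj₂)
open import Data.Sum using (inj₁; inj₂)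
open import Data.List using ([]; _∷_; map)
open import Data.Maybe using (nothing)
open import Relation.Nullary using (¬_; yes; no)
open import Relation.Binary.PropositionalEquality as ≡ using (_≡_)
open import Tactic.RingSolver.Core.AlmostCommutativeRing using (fromCommutativeRing)
import Tactic.RingSolver.NonReflective as RingSolver
import Algebra.Properties.Ring as RingProperties
import Algebra.Properties.AbelianGroup as AbelianGroupProperties
import Relation.Binary.Reasoning.Setoid as SetoidReasoning

module Digits {c ℓ : Level} (F : FiniteField c ℓ) where
  open FiniteField F hiding (zero)
  open PolyOver F
  open RingProperties (CommutativeRing.ring commRing) using (-1*x≈-x; x[y-z]≈xy-xz)
  open AbelianGroupProperties +-abelianGroup using (x∙y⁻¹≈ε⇒x≈y; x≈y⇒x∙y⁻¹≈ε; ⁻¹-∙-comm)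
  open RingSolver (fromCommutativeRing commRing (λ _ → nothing))
    using (solve; _⊜_; _⊕_)
  open SetoidReasoning setoid

  -- Differences of sums are sums of differences. (The ring solver cannot
  -- cancel x − x here, so negation is handled by this lemma.)
  [x-y]+[z-w]≈[x+z]-[y+w] : ∀ x y z w → (x - y) + (z - w) ≈ (x + z) - (y + w)
  [x-y]+[z-w]≈[x+z]-[y+w] x y z w = begin
    (x + - y) + (z + - w)    ≈⟨ solve 4 (λ x y′ z w′ → ((x ⊕ y′) ⊕ (z ⊕ w′)) ⊜ ((x ⊕ z) ⊕ (y′ ⊕ w′)))
                                      refl x (- y) z (- w) ⟩
    (x + z) + (- y + - w)    ≈⟨ +-congˡ (⁻¹-∙-comm y w) ⟩
    (x + z) - (y + w)        ∎

  coeff-+ : ∀ p r i → coeff (p +ₚ r) i ≈ coeff p i + coeff r i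
  coeff-+ []      r       i       = sym (+-identityˡ _)
  coeff-+ (a ∷ p) []      i       = sym (+-identityʳ _)
  coeff-+ (a ∷ p) (b ∷ r) zero    = refl
  coeff-+ (a ∷ p) (b ∷ r) (suc i) = coeff-+ p r i

  coeff-scale : ∀ a p i → coeff (map (a *_) p) i ≈ a * coeff p i
  coeff-scale a []      i       = sym (zeroʳ a)
  coeff-scale a (b ∷ p) zero    = refl
  coeff-scale a (b ∷ p) (suc i) = coeff-scale a p i

  infixl 6 _-ₚ_
  _-ₚ_ : Poly → Poly → Poly
  p -ₚ r = p +ₚ map ((- 1#) *_) r

  coeff-- : ∀ p r i → coeff (p -ₚ r) i ≈ coeff p i - coeff r i
  coeff-- p r i = begin
    coeff (p -ₚ r) i                         ≈⟨ coeff-+ p _ i ⟩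
    coeff p i + coeff (map ((- 1#) *_) r) i  ≈⟨ +-congˡ (coeff-scale (- 1#) r i) ⟩
    coeff p i + (- 1#) * coeff r i           ≈⟨ +-congˡ (-1*x≈-x _) ⟩
    coeff p i - coeff r i                    ∎

  coeff-sub-multiple : ∀ p k r i →
    coeff (p -ₚ map (k *_) r) i ≈ coeff p i - k * coeff r i
  coeff-sub-multiple p k r i =
    trans (coeff-- p _ i) (+-congˡ (-‿cong (coeff-scale k r i)))

  shift-zero : ∀ p → p ≈ₚ 0ₚ → (0# ∷ p) ≈ₚ 0ₚ
  shift-zero p p≈0 zero    = refl
  shift-zero p p≈0 (suc i) = p≈0 i

  cons-split : ∀ a f p r → f ≈ₚ (p +ₚ r) → (a ∷ f) ≈ₚ ((0# ∷ p) +ₚ (a ∷ r))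
  cons-split a f p r f≈ zero    = sym (+-identityˡ a)
  cons-split a f p r f≈ (suc i) = f≈ i

  coeff-*-∷ˡ : ∀ q Q w i →
    coeff ((q ∷ Q) *ₚ w) i ≈ q * coeff w i + coeff (0# ∷ (Q *ₚ w)) i
  coeff-*-∷ˡ q Q w i = trans (coeff-+ (map (q *_) w) _ i) (+-congʳ (coeff-scale q w i))

  coeff-*-∷ʳ : ∀ Q a w i →
    coeff (Q *ₚ (a ∷ w)) i ≈ a * coeff Q i + coeff (0# ∷ (Q *ₚ w)) i
  coeff-*-∷ʳ []      a w zero    = sym (trans (+-identityʳ _) (zeroʳ a))
  coeff-*-∷ʳ []      a w (suc i) = sym (trans (+-identityʳ _) (zeroʳ a))
  coeff-*-∷ʳ (q ∷ Q) a w zero    = +-congʳ (*-comm q a)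
  coeff-*-∷ʳ (q ∷ Q) a w (suc i) = begin
    coeff (map (q *_) w +ₚ Q *ₚ (a ∷ w)) i
      ≈⟨ coeff-+ (map (q *_) w) (Q *ₚ (a ∷ w)) i ⟩
    coeff (map (q *_) w) i + coeff (Q *ₚ (a ∷ w)) i
      ≈⟨ +-cong (coeff-scale q w i) (coeff-*-∷ʳ Q a w i) ⟩
    q * coeff w i + (a * coeff Q i + coeff (0# ∷ (Q *ₚ w)) i)
      ≈⟨ solve 3 (λ x y z → (x ⊕ (y ⊕ z)) ⊜ (y ⊕ (x ⊕ z))) refl _ _ _ ⟩
    a * coeff Q i + (q * coeff w i + coeff (0# ∷ (Q *ₚ w)) i)
      ≈⟨ +-congˡ (coeff-*-∷ˡ q Q w i) ⟨
    a * coeff Q i + coeff ((q ∷ Q) *ₚ w) i ∎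

  *-zeroʳₚ : ∀ Q u → u ≈ₚ 0ₚ → (Q *ₚ u) ≈ₚ 0ₚ
  *-zeroʳₚ []      u u≈0 i = refl
  *-zeroʳₚ (q ∷ Q) u u≈0 i = begin
    coeff ((q ∷ Q) *ₚ u) i                       ≈⟨ coeff-*-∷ˡ q Q u i ⟩
    q * coeff u i + coeff (0# ∷ (Q *ₚ u)) i      ≈⟨ +-cong (trans (*-congˡ (u≈0 i)) (zeroʳ q))
                                                           (shift-zero _ (*-zeroʳₚ Q u u≈0) i) ⟩
    0# + 0#                                      ≈⟨ +-identityʳ 0# ⟩
    0#                                           ∎

  coeff-*-- : ∀ Q w w′ i →
    coeff (Q *ₚ (w -ₚ w′)) i ≈ coeff (Q *ₚ w) i - coeff (Q *ₚ w′) i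
  coeff-*-- []      w w′ i = sym (-‿inverseʳ 0#)
  coeff-*-- (q ∷ Q) w w′ i = begin
    coeff ((q ∷ Q) *ₚ (w -ₚ w′)) i
      ≈⟨ coeff-*-∷ˡ q Q _ i ⟩
    q * coeff (w -ₚ w′) i + coeff (0# ∷ (Q *ₚ (w -ₚ w′))) i
      ≈⟨ +-cong (trans (*-congˡ (coeff-- w w′ i)) (x[y-z]≈xy-xz q _ _)) (shifted i) ⟩
    (q * coeff w i - q * coeff w′ i)
      + (coeff (0# ∷ (Q *ₚ w)) i - coeff (0# ∷ (Q *ₚ w′)) i)
      ≈⟨ [x-y]+[z-w]≈[x+z]-[y+w] _ _ _ _ ⟩
    (q * coeff w i + coeff (0# ∷ (Q *ₚ w)) i)
      - (q * coeff w′ i + coeff (0# ∷ (Q *ₚ w′)) i)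
      ≈⟨ +-cong (coeff-*-∷ˡ q Q w i) (-‿cong (coeff-*-∷ˡ q Q w′ i)) ⟨
    coeff ((q ∷ Q) *ₚ w) i - coeff ((q ∷ Q) *ₚ w′) i ∎
    where
    shifted : ∀ i → coeff (0# ∷ (Q *ₚ (w -ₚ w′))) i
                    ≈ coeff (0# ∷ (Q *ₚ w)) i - coeff (0# ∷ (Q *ₚ w′)) i
    shifted zero    = sym (-‿inverseʳ 0#)
    shifted (suc i) = coeff-*-- Q w w′ i

  ∣-sub : ∀ Q x y → Q ∣ₚ x → Q ∣ₚ y → Q ∣ₚ (x -ₚ y)
  ∣-sub Q x y (w , Qw≈x) (w′ , Qw′≈y) = w -ₚ w′ , λ i → begin
    coeff (Q *ₚ (w -ₚ w′)) i               ≈⟨ coeff-*-- Q w w′ i ⟩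
    coeff (Q *ₚ w) i - coeff (Q *ₚ w′) i   ≈⟨ +-cong (Qw≈x i) (-‿cong (Qw′≈y i)) ⟩
    coeff x i - coeff y i                  ≈⟨ coeff-- x y i ⟨
    coeff (x -ₚ y) i                       ∎

  module DivisionBy (Q : Poly) (n : ℕ) (degQ : HasDeg Q n) where

    lead : Carrier
    lead = coeff Q n

    lead⁻¹ : Carrier
    lead⁻¹ = proj₁ (inverse lead (proj₁ degQ))

    lead*lead⁻¹ : lead * lead⁻¹ ≈ 1#
    lead*lead⁻¹ = proj₂ (inverse lead (proj₁ degQ))

    Q-vanishes-above : ∀ i → n < i → coeff Q i ≈ 0#
    Q-vanishes-above = proj₂ degQ

    eliminate-top : ∀ g → DegLt g (suc n) → ∃ λ k → DegLt (g -ₚ map (k *_) Q) n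
    eliminate-top g deg≤n = k , deg<n
      where
      k : Carrier
      k = coeff g n * lead⁻¹

      k*lead : k * lead ≈ coeff g n
      k*lead = begin
        coeff g n * lead⁻¹ * lead    ≈⟨ *-assoc _ _ _ ⟩
        coeff g n * (lead⁻¹ * lead)  ≈⟨ *-congˡ (trans (*-comm _ _) lead*lead⁻¹) ⟩
        coeff g n * 1#               ≈⟨ *-identityʳ _ ⟩
        coeff g n                    ∎

      deg<n : DegLt (g -ₚ map (k *_) Q) n
      deg<n i n≤i with ℕP.m≤n⇒m<n∨m≡n n≤i
      ... | inj₁ n<i = begin
        coeff (g -ₚ map (k *_) Q) i  ≈⟨ coeff-sub-multiple g k Q i ⟩
        coeff g i - k * coeff Q i    ≈⟨ +-cong (deg≤n i n<i)
                                         (-‿cong (trans (*-congˡ (Q-vanishes-above i n<i)) (zeroʳ k))) ⟩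
        0# - 0#                      ≈⟨ -‿inverseʳ 0# ⟩
        0#                           ∎
      ... | inj₂ ≡.refl = begin
        coeff (g -ₚ map (k *_) Q) n  ≈⟨ coeff-sub-multiple g k Q n ⟩
        coeff g n - k * lead         ≈⟨ +-congˡ (-‿cong k*lead) ⟩
        coeff g n - coeff g n        ≈⟨ -‿inverseʳ _ ⟩
        0#                           ∎

    divide : ∀ f → ∃₂ λ w r → DegLt r n × f ≈ₚ (Q *ₚ w +ₚ r)
    divide [] = [] , [] , (λ _ _ → refl) , λ i → sym (begin
      coeff (Q *ₚ [] +ₚ []) i   ≈⟨ coeff-+ (Q *ₚ []) [] i ⟩
      coeff (Q *ₚ []) i + 0#    ≈⟨ +-identityʳ _ ⟩
      coeff (Q *ₚ []) i         ≈⟨ *-zeroʳₚ Q [] (λ _ → refl) i ⟩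
      0#                        ∎)
    divide (a ∷ f) with divide f
    ... | w , r , deg-r , f≈ with eliminate-top (a ∷ r) deg-a∷r
      where
      deg-a∷r : DegLt (a ∷ r) (suc n)
      deg-a∷r (suc i) (s≤s n≤i) = deg-r i n≤i
    ... | k , deg-r′ = k ∷ w , r′ , deg-r′ , a∷f≈
      where
      r′ = (a ∷ r) -ₚ map (k *_) Q

      a∷f≈ : (a ∷ f) ≈ₚ (Q *ₚ (k ∷ w) +ₚ r′)
      a∷f≈ i = begin
        coeff (a ∷ f) i
          ≈⟨ cons-split a f (Q *ₚ w) r f≈ i ⟩
        coeff ((0# ∷ (Q *ₚ w)) +ₚ (a ∷ r)) i
          ≈⟨ coeff-+ (0# ∷ (Q *ₚ w)) (a ∷ r) i ⟩
        coeff (0# ∷ (Q *ₚ w)) i + coeff (a ∷ r) i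
          ≈⟨ +-identityʳ _ ⟨
        coeff (0# ∷ (Q *ₚ w)) i + coeff (a ∷ r) i + 0#
          ≈⟨ +-congˡ (-‿inverseʳ (k * coeff Q i)) ⟨
        coeff (0# ∷ (Q *ₚ w)) i + coeff (a ∷ r) i + (k * coeff Q i - k * coeff Q i)
          ≈⟨ solve 4 (λ x y z x′ → ((y ⊕ z) ⊕ (x ⊕ x′)) ⊜ ((x ⊕ y) ⊕ (z ⊕ x′))) refl _ _ _ _ ⟩
        (k * coeff Q i + coeff (0# ∷ (Q *ₚ w)) i) + (coeff (a ∷ r) i - k * coeff Q i)
          ≈⟨ +-cong (coeff-*-∷ʳ Q k w i) (coeff-sub-multiple (a ∷ r) k Q i) ⟨
        coeff (Q *ₚ (k ∷ w)) i + coeff r′ i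
          ≈⟨ coeff-+ (Q *ₚ (k ∷ w)) r′ i ⟨
        coeff (Q *ₚ (k ∷ w) +ₚ r′) i ∎

    -- deg (Q·u) = n + deg u; in particular Q·u of degree < n forces u = 0.
    small-multiple⇒zero : ∀ u → DegLt (Q *ₚ u) n → u ≈ₚ 0ₚ
    small-multiple⇒zero []      _     = λ _ → refl
    small-multiple⇒zero (a ∷ u) small = a∷u≈0
      where
      Qu-small : DegLt (Q *ₚ u) n
      Qu-small j n≤j = begin
        coeff (Q *ₚ u) j
          ≈⟨ +-identityˡ _ ⟨
        0# + coeff (0# ∷ (Q *ₚ u)) (suc j)
          ≈⟨ +-congʳ (trans (*-congˡ (Q-vanishes-above (suc j) (s≤s n≤j))) (zeroʳ a)) ⟨
        a * coeff Q (suc j) + coeff (0# ∷ (Q *ₚ u)) (suc j)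
          ≈⟨ coeff-*-∷ʳ Q a u (suc j) ⟨
        coeff (Q *ₚ (a ∷ u)) (suc j)
          ≈⟨ small (suc j) (ℕP.m≤n⇒m≤1+n n≤j) ⟩
        0# ∎

      u≈0 : u ≈ₚ 0ₚ
      u≈0 = small-multiple⇒zero u Qu-small

      a*lead≈0 : a * lead ≈ 0#
      a*lead≈0 = begin
        a * lead                                ≈⟨ +-identityʳ _ ⟨
        a * lead + 0#                           ≈⟨ +-congˡ (shift-zero _ (*-zeroʳₚ Q u u≈0) n) ⟨
        a * lead + coeff (0# ∷ (Q *ₚ u)) n      ≈⟨ coeff-*-∷ʳ Q a u n ⟨
        coeff (Q *ₚ (a ∷ u)) n                  ≈⟨ small n ℕP.≤-refl ⟩
        0#                                      ∎

      a≈0 : a ≈ 0#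
      a≈0 = begin
        a                    ≈⟨ *-identityʳ a ⟨
        a * 1#               ≈⟨ *-congˡ lead*lead⁻¹ ⟨
        a * (lead * lead⁻¹)  ≈⟨ *-assoc a lead lead⁻¹ ⟨
        a * lead * lead⁻¹    ≈⟨ *-congʳ a*lead≈0 ⟩
        0# * lead⁻¹          ≈⟨ zeroˡ lead⁻¹ ⟩
        0#                   ∎

      a∷u≈0 : (a ∷ u) ≈ₚ 0ₚ
      a∷u≈0 zero    = a≈0
      a∷u≈0 (suc i) = u≈0 i

    divisible-small⇒zero : ∀ d → Q ∣ₚ d → DegLt d n → d ≈ₚ 0ₚ
    divisible-small⇒zero d (w , Qw≈d) small i = begin
      coeff d i          ≈⟨ Qw≈d i ⟨
      coeff (Q *ₚ w) i   ≈⟨ *-zeroʳₚ Q w w≈0 i ⟩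
      0#                 ∎
      where
      w≈0 : w ≈ₚ 0ₚ
      w≈0 = small-multiple⇒zero w (λ j n≤j → trans (Qw≈d j) (small j n≤j))

  window : Laurent → ℕ → ℕ → Poly
  window β o zero    = []
  window β o (suc k) = lcoeff β (+ o) ∷ window β (suc o) k

  window-< : ∀ β o k i → i < k → coeff (window β o k) i ≡ lcoeff β (+ (o ℕ.+ i))
  window-< β o (suc k) zero    _       rewrite ℕP.+-identityʳ o = ≡.refl
  window-< β o (suc k) (suc i) (s≤s p) rewrite ℕP.+-suc o i = window-< β (suc o) k i p

  window-≥ : ∀ β o k i → k ≤ i → coeff (window β o k) i ≡ 0#
  window-≥ β o zero    i       _       = ≡.refl
  window-≥ β o (suc k) (suc i) (s≤s p) = window-≥ β (suc o) k i p

  truncate : Laurent → ℕ → Poly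
  truncate β m = window β 0 m

  AgreeFrom : ℕ → Poly → Laurent → Set ℓ
  AgreeFrom n s β = ∀ j → n ≤ j → coeff s j ≈ lcoeff β (+ j)

  agree⇒deg-lt : ∀ n s β → AgreeFrom n s β → LDegLt (β -ₗ s) (+ n)
  agree⇒deg-lt n s β agree (+ j) (ℤ.+≤+ n≤j) = x≈y⇒x∙y⁻¹≈ε (sym (agree j n≤j))

  deg-lt⇒agree : ∀ n s β → LDegLt (β -ₗ s) (+ n) → AgreeFrom n s β
  deg-lt⇒agree n s β small j n≤j = sym (x∙y⁻¹≈ε⇒x≈y _ _ (small (+ j) (ℤ.+≤+ n≤j)))

  module DigitOf (Q : Poly) (n : ℕ) (degQ : HasDeg Q n) where
    open DivisionBy Q n degQ

    -- The digit s = t − (a + t mod Q), t the truncation of β below degree m.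
    digit-exists : ∀ a β m → n < m → LDegLt (lcoeff β) (+ m) →
      ∃ λ s → DegLt s m × Q ∣ₚ (a +ₚ s) × AgreeFrom n s β
    digit-exists a β m n<m deg-β with divide (a +ₚ truncate β m)
    ... | w , r , deg-r , a+t≈ = s , deg-s , (w , Qw≈a+s) , s-agrees
      where
      t = truncate β m
      s = t -ₚ r

      deg-s : DegLt s m
      deg-s i m≤i = begin
        coeff s i              ≈⟨ coeff-- t r i ⟩
        coeff t i - coeff r i  ≈⟨ +-cong (reflexive (window-≥ β 0 m i m≤i))
                                    (-‿cong (deg-r i (ℕP.≤-trans (ℕP.<⇒≤ n<m) m≤i))) ⟩
        0# - 0#                ≈⟨ -‿inverseʳ 0# ⟩
        0#                     ∎

      Qw≈a+s : (Q *ₚ w) ≈ₚ (a +ₚ s)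
      Qw≈a+s i = begin
        coeff (Q *ₚ w) i
          ≈⟨ +-identityʳ _ ⟨
        coeff (Q *ₚ w) i + 0#
          ≈⟨ +-congˡ (-‿inverseʳ (coeff r i)) ⟨
        coeff (Q *ₚ w) i + (coeff r i - coeff r i)
          ≈⟨ +-assoc _ _ _ ⟨
        (coeff (Q *ₚ w) i + coeff r i) - coeff r i
          ≈⟨ +-congʳ (trans (a+t≈ i) (coeff-+ (Q *ₚ w) r i)) ⟨
        coeff (a +ₚ t) i - coeff r i
          ≈⟨ +-congʳ (coeff-+ a t i) ⟩
        (coeff a i + coeff t i) - coeff r i
          ≈⟨ +-assoc _ _ _ ⟩
        coeff a i + (coeff t i - coeff r i)
          ≈⟨ +-congˡ (coeff-- t r i) ⟨
        coeff a i + coeff s i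
          ≈⟨ coeff-+ a s i ⟨
        coeff (a +ₚ s) i ∎

      -- Below m the digit is t minus a remainder vanishing above n;
      -- from m on both s and β vanish.
      s-agrees : AgreeFrom n s β
      s-agrees j n≤j with j ℕP.<? m
      ... | yes j<m = begin
        coeff s j              ≈⟨ coeff-- t r j ⟩
        coeff t j - coeff r j  ≈⟨ +-cong (reflexive (window-< β 0 m j j<m)) (-‿cong (deg-r j n≤j)) ⟩
        lcoeff β (+ j) - 0#    ≈⟨ +-congˡ -0#≈0# ⟩
        lcoeff β (+ j) + 0#    ≈⟨ +-identityʳ _ ⟩
        lcoeff β (+ j)         ∎
        where
        -0#≈0# : - 0# ≈ 0#
        -0#≈0# = trans (sym (+-identityˡ (- 0#))) (-‿inverseʳ 0#)
      ... | no j≮m = trans (deg-s j m≤j) (sym (deg-β (+ j) (ℤ.+≤+ m≤j)))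
        where m≤j = ℕP.≮⇒≥ j≮m

    -- Two digits agreeing with β from degree n on differ by a multiple of
    -- Q of degree < n, hence coincide.
    digit-unique : ∀ a β s s′ → Q ∣ₚ (a +ₚ s) → Q ∣ₚ (a +ₚ s′) →
      AgreeFrom n s β → AgreeFrom n s′ β → s′ ≈ₚ s
    digit-unique a β s s′ Q∣a+s Q∣a+s′ s-agrees s′-agrees i =
      x∙y⁻¹≈ε⇒x≈y _ _ (trans (sym (coeff-difference i)) (difference≈0 i))
      where
      difference = (a +ₚ s′) -ₚ (a +ₚ s)

      coeff-difference : ∀ i → coeff difference i ≈ coeff s′ i - coeff s i
      coeff-difference i = begin
        coeff difference i
          ≈⟨ coeff-- (a +ₚ s′) (a +ₚ s) i ⟩
        coeff (a +ₚ s′) i - coeff (a +ₚ s) i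
          ≈⟨ +-cong (coeff-+ a s′ i) (-‿cong (coeff-+ a s i)) ⟩
        (coeff a i + coeff s′ i) - (coeff a i + coeff s i)
          ≈⟨ [x-y]+[z-w]≈[x+z]-[y+w] _ _ _ _ ⟨
        (coeff a i - coeff a i) + (coeff s′ i - coeff s i)
          ≈⟨ +-congʳ (-‿inverseʳ (coeff a i)) ⟩
        0# + (coeff s′ i - coeff s i)
          ≈⟨ +-identityˡ _ ⟩
        coeff s′ i - coeff s i ∎

      difference-small : DegLt difference n
      difference-small j n≤j = begin
        coeff difference j                  ≈⟨ coeff-difference j ⟩
        coeff s′ j - coeff s j              ≈⟨ +-cong (s′-agrees j n≤j) (-‿cong (s-agrees j n≤j)) ⟩
        lcoeff β (+ j) - lcoeff β (+ j)     ≈⟨ -‿inverseʳ _ ⟩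
        0#                                  ∎

      difference≈0 : difference ≈ₚ 0ₚ
      difference≈0 = divisible-small⇒zero difference
        (∣-sub Q (a +ₚ s′) (a +ₚ s) Q∣a+s′ Q∣a+s) difference-small

lemma5p6 : ∀ {c ℓ} (F : FiniteField c ℓ) → let open PolyOver F in
    ∀ (P Q : Poly) (m n : ℕ) →
    ¬ (P ≈ₚ 0ₚ) → ¬ (Q ≈ₚ 0ₚ) → Coprime P Q →
    HasDeg P m → HasDeg Q n → n < m →
    ∀ (v : Poly) (β : Laurent) → LDegLt (lcoeff β) (+ m) →
    ∃ λ s → (InL P Q m v s × LDegLt (β -ₗ s) (+ n))
    × (∀ s′ → InL P Q m v s′ → LDegLt (β -ₗ s′) (+ n) → s′ ≈ₚ s)
lemma5p6 F P Q m n _ _ _ _ degQ n<m v β deg-β =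
  let open PolyOver F
      open Digits F
      open DigitOf Q n degQ
      (s , deg-s , Q∣Pv+s , s-agrees) = digit-exists (P *ₚ v) β m n<m deg-β
  in s , ((deg-s , Q∣Pv+s) , agree⇒deg-lt n s β s-agrees) ,
     λ s′ (_ , Q∣Pv+s′) β-s′<n →
       digit-unique (P *ₚ v) β s s′ Q∣Pv+s Q∣Pv+s′ s-agrees (deg-lt⇒agree n s′ β β-s′<n)
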